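{- Let $G$ be a finite undirected graph and $A$ an abelian group. If $g:V\to A$ is balanceable, then $g(v)-g(w)\in 2A$ for any two $3$-edge-connected vertices $v,w$ of $G$.
   Context: Graphs are finite, undirected, may have multiple edges and loops, and need not be connected, with vertex set $V$ and edge set $E$. A truncated trail (ttrail) from $x$ to $y$ is a sequence $v_1,e_1,\dots,v_n,e_n$ with $v_1=x$, each $e_j$ joining $v_j$ and $v_{j+1}$ (where $v_{n+1}=y$), edges pairwise distinct; it is closed if $x=y$. $g:V\to A$ is balanceable if there is $f:E\to A$ with $g(v_1)+f(e_1)+\dots+g(v_n)+f(e_n)=0$ for every closed ttrail $v_1,e_1,\dots,v_n,e_n$. $2A=\{2a:a\in A\}$. Two distinct vertices are $3$-edge-connected if there are $3$ pairwise edge-disjoint ttrails between them; each vertex is $3$-edge-connected to itself. -}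

module Defs where

open import Level using (Level; _⊔_)
open import Data.Nat using (ℕ)
open import Data.Fin using (Fin)
open import Data.Product using (Σ; ∃; _×_; _,_; proj₁; proj₂)
open import Data.Sum using (_⊎_)
open import Data.List using (List; []; _∷_; map)
open import Data.List.Membership.Propositional using (_∈_)
open import Data.List.Relation.Unary.Unique.Propositional using (Unique)
open import Data.Empty using (⊥)
open import Relation.Nullary using (¬_)
open import Relation.Binary.PropositionalEquality using (_≡_; _≢_)
open import Algebra.Bundles using (AbelianGroup)

-- A finite multigraph (loops and parallel edges allowed, not necessarily
-- connected): vertices Fin nV, edges Fin nE, each edge has two endpoints.
record Graph : Set where
  field
    nV  : ℕ
    nE  : ℕ
    ends : Fin nE → Fin nV × Fin nV

module _ (G : Graph) where
  open Graph G

  V : Set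
  V = Fin nV

  E : Set
  E = Fin nE

  Joins : E → V → V → Set
  Joins e u w = (ends e ≡ (u , w)) ⊎ (ends e ≡ (w , u))

  -- A sequence v₁,e₁,…,vₙ,eₙ (as a list of pairs (vⱼ , eⱼ)) starting at x
  -- with each eⱼ joining vⱼ and vⱼ₊₁, where vₙ₊₁ = y.
  IsWalk : V → List (V × E) → V → Set
  IsWalk x [] y = x ≡ y
  IsWalk x ((v , e) ∷ r) y = (v ≡ x) × Σ V (λ u → Joins e v u × IsWalk u r y)

  edgesOf : List (V × E) → List E
  edgesOf = map proj₂

  IsTTrail : V → List (V × E) → V → Set
  IsTTrail x t y = (t ≢ []) × IsWalk x t y × Unique (edgesOf t)

  EdgeDisjoint : List (V × E) → List (V × E) → Set
  EdgeDisjoint s t = ∀ e → e ∈ edgesOf s → e ∈ edgesOf t → ⊥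

  ThreeEdgeConnected : V → V → Set
  ThreeEdgeConnected v w =
    (v ≡ w) ⊎
    ((v ≢ w) × Σ (List (V × E)) λ t₁ → Σ (List (V × E)) λ t₂ → Σ (List (V × E)) λ t₃ →
       IsTTrail v t₁ w × IsTTrail v t₂ w × IsTTrail v t₃ w ×
       EdgeDisjoint t₁ t₂ × EdgeDisjoint t₁ t₃ × EdgeDisjoint t₂ t₃)

  module _ {c ℓ : Level} (A : AbelianGroup c ℓ) where
    open AbelianGroup A renaming (Carrier to ∣A∣)

    weight : (V → ∣A∣) → (E → ∣A∣) → List (V × E) → ∣A∣
    weight g f [] = ε
    weight g f ((v , e) ∷ r) = g v ∙ (f e ∙ weight g f r)

    Balanceable : (V → ∣A∣) → Set (c ⊔ ℓ)
    Balanceable g = Σ (E → ∣A∣) λ f →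
      ∀ (x : V) (t : List (V × E)) → IsTTrail x t x → weight g f t ≈ ε

    InTwoA : ∣A∣ → Set (c ⊔ ℓ)
    InTwoA a = Σ ∣A∣ λ b → (b ∙ b) ≈ a

-- Reversing a ttrail t from v to w shifts every vertex label one step along the
-- trail, so its weight W(t̄) satisfies W(t̄) + g(v) = W(t) + g(w).  For two
-- edge-disjoint ttrails s, t from v to w, s followed by t̄ is a closed ttrail, so
-- W(s) + W(t̄) = 0 under a balancing f.  With three pairwise edge-disjoint ttrails
-- t₁, t₂, t₃ this gives W(t₁) = −W(t̄₃) = W(t₂), hence
-- 2 W(t₁) = W(t₁) + W(t₂) = −W(t̄₂) + W(t₂) = g(v) − g(w).
module Submission where

open import Defs
open import Algebra.Bundles using (AbelianGroup)
open import Data.Fin using (zero; suc)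
open import Data.Vec using ([]; _∷_)
open import Data.Product using (_×_; _,_; proj₂)
open import Data.Sum using (inj₁; inj₂)
open import Data.List using (List; []; _∷_; _++_; [_]; reverse)
open import Data.List.Properties using (map-++; unfold-reverse)
open import Data.List.Relation.Unary.Any.Properties using (reverse⁻)
open import Data.List.Membership.Propositional using (_∈_)
open import Data.List.Relation.Unary.Unique.Propositional using (Unique)
open import Data.List.Relation.Unary.Unique.Propositional.Properties using (++⁺)
open import Data.List.Relation.Binary.Permutation.Propositional using (↭-sym; ↭⇒↭ₛ)
open import Data.List.Relation.Binary.Permutation.Propositional.Properties using (↭-reverse)
import Data.List.Relation.Binary.Permutation.Setoid.Properties as Permutationₛ
open import Relation.Binary.PropositionalEquality as ≡
  using (_≡_; _≢_; refl; cong; subst; module ≡-Reasoning)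
import Algebra.Properties.Group as GroupProperties
import Algebra.Solver.CommutativeMonoid as CommutativeMonoidSolver

Unique-reverse : ∀ {a} {X : Set a} {xs : List X} → Unique xs → Unique (reverse xs)
Unique-reverse {X = X} {xs} =
  Permutationₛ.Unique-resp-↭ (≡.setoid X) (↭⇒↭ₛ (↭-sym (↭-reverse xs)))

++-≢-[] : ∀ {a} {X : Set a} {xs : List X} (ys : List X) → xs ≢ [] → xs ++ ys ≢ []
++-≢-[] {xs = []}    ys xs≢[] _ = xs≢[] refl
++-≢-[] {xs = _ ∷ _} ys xs≢[] ()

module _ (G : Graph) where

  private
    Seq : Set
    Seq = List (V G × E G)

  Joins-sym : ∀ {e u w} → Joins G e u w → Joins G e w u
  Joins-sym (inj₁ p) = inj₂ p
  Joins-sym (inj₂ p) = inj₁ p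

  headVertex : V G → Seq → V G
  headVertex y []            = y
  headVertex y ((v , _) ∷ _) = v

  IsWalk⇒headVertex≡ : ∀ {x y} t → IsWalk G x t y → headVertex y t ≡ x
  IsWalk⇒headVertex≡ []      y≡x       = ≡.sym y≡x
  IsWalk⇒headVertex≡ (_ ∷ _) (v≡x , _) = v≡x

  IsWalk-++ : ∀ {x y z} s {t} → IsWalk G x s y → IsWalk G y t z → IsWalk G x (s ++ t) z
  IsWalk-++ []      refl                 wt = wt
  IsWalk-++ (_ ∷ s) (v≡x , u , j , ws) wt = v≡x , u , j , IsWalk-++ s ws wt

  -- y is the end point of the walk, i.e. the start of its reverse.
  reverseWalk : V G → Seq → Seq
  reverseWalk y []            = []
  reverseWalk y ((_ , e) ∷ r) = reverseWalk y r ++ [ headVertex y r , e ]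

  edgesOf-reverseWalk : ∀ y t → edgesOf G (reverseWalk y t) ≡ reverse (edgesOf G t)
  edgesOf-reverseWalk y []            = refl
  edgesOf-reverseWalk y ((_ , e) ∷ r) = begin
    edgesOf G (reverseWalk y r ++ [ headVertex y r , e ])
      ≡⟨ map-++ proj₂ (reverseWalk y r) _ ⟩
    edgesOf G (reverseWalk y r) ++ [ e ]
      ≡⟨ cong (_++ [ e ]) (edgesOf-reverseWalk y r) ⟩
    reverse (edgesOf G r) ++ [ e ]
      ≡⟨ ≡.sym (unfold-reverse e (edgesOf G r)) ⟩
    reverse (e ∷ edgesOf G r) ∎
    where open ≡-Reasoning

  IsWalk-reverseWalk : ∀ {x y} t → IsWalk G x t y → IsWalk G y (reverseWalk y t) x
  IsWalk-reverseWalk []            refl                 = refl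
  IsWalk-reverseWalk {x} {y} ((_ , e) ∷ r) (refl , u , j , wr)
    rewrite IsWalk⇒headVertex≡ r wr =
    IsWalk-++ (reverseWalk y r) (IsWalk-reverseWalk r wr) (refl , x , Joins-sym j , refl)

  IsTTrail-++-reverseWalk : ∀ {v w s t} → IsTTrail G v s w → IsTTrail G v t w →
    EdgeDisjoint G s t → IsTTrail G v (s ++ reverseWalk w t) v
  IsTTrail-++-reverseWalk {w = w} {s} {t} (s≢[] , ws , us) (_ , wt , ut) disjoint =
    ++-≢-[] _ s≢[] ,
    IsWalk-++ s ws (IsWalk-reverseWalk t wt) ,
    subst Unique (≡.sym (map-++ proj₂ s (reverseWalk w t)))
      (++⁺ us unique-reverse λ (e∈s , e∈t̄) → disjoint _ e∈s (reverse⁻ (subst (_ ∈_)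
        (edgesOf-reverseWalk w t) e∈t̄)))
    where
    unique-reverse : Unique (edgesOf G (reverseWalk w t))
    unique-reverse = subst Unique (≡.sym (edgesOf-reverseWalk w t)) (Unique-reverse ut)

  module _ {c ℓ} (A : AbelianGroup c ℓ) where
    open AbelianGroup A renaming (Carrier to ∣A∣; refl to ≈-refl)
    open GroupProperties group using (x≈z//y; ∙-cancelʳ)
    open CommutativeMonoidSolver commutativeMonoid using (prove; var; _⊕_) renaming (id to ∅)
    open import Relation.Binary.Reasoning.Setoid setoid

    module _ (g : V G → ∣A∣) (f : E G → ∣A∣) where

      private
        W : Seq → ∣A∣
        W = weight G A g f

      weight-++ : ∀ s t → W (s ++ t) ≈ W s ∙ W t
      weight-++ []            t = sym (identityˡ (W t))
      weight-++ ((v , e) ∷ r) t = begin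
        g v ∙ (f e ∙ W (r ++ t))    ≈⟨ ∙-congˡ (∙-congˡ (weight-++ r t)) ⟩
        g v ∙ (f e ∙ (W r ∙ W t))   ≈⟨ sym (∙-congˡ (assoc (f e) (W r) (W t))) ⟩
        g v ∙ ((f e ∙ W r) ∙ W t)   ≈⟨ sym (assoc (g v) (f e ∙ W r) (W t)) ⟩
        (g v ∙ (f e ∙ W r)) ∙ W t   ∎

      -- In the reverse each edge is preceded by the other end point.
      weight-reverseWalk : ∀ {x y} t → IsWalk G x t y →
        W (reverseWalk y t) ∙ g x ≈ W t ∙ g y
      weight-reverseWalk [] refl = ≈-refl
      weight-reverseWalk {x} {y} ((_ , e) ∷ r) (refl , u , _ , wr)
        rewrite IsWalk⇒headVertex≡ r wr = begin
          W (R ++ [ u , e ]) ∙ g x            ≈⟨ ∙-congʳ (weight-++ R [ u , e ]) ⟩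
          (W R ∙ (g u ∙ (f e ∙ ε))) ∙ g x     ≈⟨ prove 4 ((α ⊕ (β ⊕ (γ ⊕ ∅))) ⊕ δ)
                                                      ((α ⊕ β) ⊕ (γ ⊕ δ)) (W R ∷ g u ∷ f e ∷ g x ∷ []) ⟩
          (W R ∙ g u) ∙ (f e ∙ g x)           ≈⟨ ∙-congʳ (weight-reverseWalk r wr) ⟩
          (W r ∙ g y) ∙ (f e ∙ g x)           ≈⟨ prove 4 ((α ⊕ β) ⊕ (γ ⊕ δ)) ((δ ⊕ (γ ⊕ α)) ⊕ β)
                                                      (W r ∷ g y ∷ f e ∷ g x ∷ []) ⟩
          (g x ∙ (f e ∙ W r)) ∙ g y           ∎
        where
        R = reverseWalk y r
        α = var zero
        β = var (suc zero)
        γ = var (suc (suc zero))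
        δ = var (suc (suc (suc zero)))

      module _ (balanced : ∀ x t → IsTTrail G x t x → W t ≈ ε) {v w : V G} where

        weight-∙-reverseWalk≈ε : ∀ {s t} → IsTTrail G v s w → IsTTrail G v t w →
          EdgeDisjoint G s t → W s ∙ W (reverseWalk w t) ≈ ε
        weight-∙-reverseWalk≈ε {s} {t} ts tt disjoint =
          trans (sym (weight-++ s (reverseWalk w t)))
                (balanced v _ (IsTTrail-++-reverseWalk ts tt disjoint))

        weight-doubled≈difference : ∀ {s t} → IsTTrail G v s w → IsTTrail G v t w →
          EdgeDisjoint G s t → W s ≈ W t → W s ∙ W s ≈ g v ∙ g w ⁻¹
        weight-doubled≈difference {s} {t} ts tt@(_ , wt , _) s#t Ws≈Wt = x≈z//y _ (g w) (g v) (begin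
          (W s ∙ W s) ∙ g w                  ≈⟨ ∙-congʳ (∙-congˡ Ws≈Wt) ⟩
          (W s ∙ W t) ∙ g w                  ≈⟨ assoc (W s) (W t) (g w) ⟩
          W s ∙ (W t ∙ g w)                  ≈⟨ ∙-congˡ (sym (weight-reverseWalk t wt)) ⟩
          W s ∙ (W (reverseWalk w t) ∙ g v)  ≈⟨ sym (assoc (W s) _ (g v)) ⟩
          (W s ∙ W (reverseWalk w t)) ∙ g v  ≈⟨ ∙-congʳ (weight-∙-reverseWalk≈ε ts tt s#t) ⟩
          ε ∙ g v                            ≈⟨ identityˡ (g v) ⟩
          g v                                ∎)

        weight-≈-via-disjoint : ∀ {s t u} → IsTTrail G v s w → IsTTrail G v t w → IsTTrail G v u w →
          EdgeDisjoint G s u → EdgeDisjoint G t u → W s ≈ W t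
        weight-≈-via-disjoint {u = u} ts tt tu s#u t#u = ∙-cancelʳ (W (reverseWalk w u)) _ _
          (trans (weight-∙-reverseWalk≈ε ts tu s#u) (sym (weight-∙-reverseWalk≈ε tt tu t#u)))

mainTheorem9 : ∀ {c ℓ} (G : Graph) (A : AbelianGroup c ℓ)
    (g : V G → AbelianGroup.Carrier A) →
    Balanceable G A g →
    ∀ (v w : V G) → ThreeEdgeConnected G v w →
    InTwoA G A (AbelianGroup._∙_ A (g v) (AbelianGroup._⁻¹ A (g w)))
mainTheorem9 G A g (f , balanced) v .v (inj₁ refl) =
  ε , trans (identityˡ ε) (sym (inverseʳ (g v)))
  where open AbelianGroup A
mainTheorem9 G A g (f , balanced) v w
  (inj₂ (_ , t₁ , t₂ , t₃ , tt₁ , tt₂ , tt₃ , disjoint₁₂ , disjoint₁₃ , disjoint₂₃)) =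
  weight G A g f t₁ ,
  weight-doubled≈difference G A g f balanced tt₁ tt₂ disjoint₁₂
    (weight-≈-via-disjoint G A g f balanced tt₁ tt₂ tt₃ disjoint₁₃ disjoint₂₃)
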